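{- For every integer $n\ge 1$, $$L_{n,2}=\binom{M_{n-1}}{2}-3(n-1)^2=\frac38(n-1)(n-2)(3n^2+3n-4),$$ where $M_{n-1}=3n(n-1)/2$.
   Context: Let $n\ge 1$ be an integer. Subdivide an equilateral triangle of side length $n$ into $n^2$ equilateral unit triangles by dividing each side into $n$ equal segments and drawing through the division points all lines parallel to the three sides. An edge of this subdivision (a side of a unit triangle) is called inner if it does not lie on the boundary of the big triangle; there are $M_{n-1}=3n(n-1)/2$ inner edges. Removing an inner edge merges the two unit triangles sharing it into a lozenge. For $l\ge 0$, $L_{n,l}$ denotes the number of sets of $l$ inner edges such that no two edges of the set are sides of the same unit triangle (equivalently, the number of ways to place $l$ non-overlapping lozenges, each the union of two adjacent unit triangles, in the big triangle, the remaining $n^2-2l$ unit triangles being left uncovered). Configurations related by symmetries of the big triangle are counted as distinct. -}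

module Defs where

open import Data.Nat using (ℕ; zero; suc; _+_; _*_; _∸_; _≡ᵇ_; _≤ᵇ_)
open import Data.Bool using (Bool; true; false; _∧_; _∨_; not; if_then_else_)
open import Data.List using (List; []; _∷_; _++_; map; concatMap; filter; length; upTo)
open import Data.Bool.ListAction using (any; all)
open import Data.Product using (_×_; _,_; proj₁; proj₂)
open import Relation.Nullary.Decidable using (Dec; yes; no)
open import Data.Bool using (T)
open import Data.Bool.Properties using (T?)

-- Lattice points of the big triangle of side n: (a , b) with a + b ≤ n
-- (a, b are coordinates along two sides; the third side is a + b = n).
Point : Set
Point = ℕ × ℕ

_==ₚ_ : Point → Point → Bool
(a , b) ==ₚ (c , d) = (a ≡ᵇ c) ∧ (b ≡ᵇ d)

Edge : Set
Edge = Point × Point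

UTri : Set
UTri = Point × Point × Point

pts : ℕ → List Point
pts k = concatMap (λ a → map (λ b → (a , b)) (upTo (suc (k ∸ a)))) (upTo (suc k))

-- all edges of the subdivision of the triangle of side n: for each lattice point,
-- the three unit segments in the three directions (each edge listed exactly once)
edges : ℕ → List Edge
edges zero = []
edges (suc m) = concatMap (λ p → let a = proj₁ p ; b = proj₂ p in
                   ((a , b) , (suc a , b)) ∷ ((a , b) , (a , suc b)) ∷ ((suc a , b) , (a , suc b)) ∷ [])
                 (pts m)

-- all n² unit triangles: upward (a,b),(a+1,b),(a,b+1) with a+b+1 ≤ n and
-- downward (a+1,b),(a,b+1),(a+1,b+1) with a+b+2 ≤ n
unitTriangles : ℕ → List UTri
unitTriangles zero = []
unitTriangles (suc m) =
  map (λ p → let a = proj₁ p ; b = proj₂ p in (a , b) , (suc a , b) , (a , suc b)) (pts m)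
  ++ downs m
  where
  downs : ℕ → List UTri
  downs zero = []
  downs (suc k) = map (λ p → let a = proj₁ p ; b = proj₂ p in (suc a , b) , (a , suc b) , (suc a , suc b)) (pts k)

onSide₁ onSide₂ onSide₃ : ℕ → Point → Bool
onSide₁ n (a , b) = a ≡ᵇ 0
onSide₂ n (a , b) = b ≡ᵇ 0
onSide₃ n (a , b) = (a + b) ≡ᵇ n

onBoundary : ℕ → Edge → Bool
onBoundary n (p , q) =
  (onSide₁ n p ∧ onSide₁ n q) ∨ (onSide₂ n p ∧ onSide₂ n q) ∨ (onSide₃ n p ∧ onSide₃ n q)

innerEdges : ℕ → List Edge
innerEdges n = filter (λ e → T? (not (onBoundary n e))) (edges n)

isVertexOf : Point → UTri → Bool
isVertexOf p (x , y , z) = (p ==ₚ x) ∨ (p ==ₚ y) ∨ (p ==ₚ z)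

isSideOf : Edge → UTri → Bool
isSideOf (p , q) t = isVertexOf p t ∧ isVertexOf q t

shareTriangle : ℕ → Edge → Edge → Bool
shareTriangle n e f = any (λ t → isSideOf e t ∧ isSideOf f t) (unitTriangles n)

subsetsOfSize : {A : Set} → ℕ → List A → List (List A)
subsetsOfSize zero xs = [] ∷ []
subsetsOfSize (suc l) [] = []
subsetsOfSize (suc l) (x ∷ xs) = map (x ∷_) (subsetsOfSize l xs) ++ subsetsOfSize (suc l) xs

admissible : ℕ → List Edge → Bool
admissible n [] = true
admissible n (e ∷ es) = all (λ f → not (shareTriangle n e f)) es ∧ admissible n es

L : ℕ → ℕ → ℕ
L n l = length (filter (λ s → T? (admissible n s)) (subsetsOfSize l (innerEdges n)))

-- M_{n-1} = 3n(n-1)/2, written as a function of n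
Mpred : ℕ → ℕ
Mpred n = Data.Nat._/_ (3 * n * (n ∸ 1)) 2

-- Two inner edges either share a unit triangle or not, so L_{n,2} = C(M,2) − P, where P counts the
-- unordered pairs of inner edges sharing a triangle, and by the handshake identity 2P + M = Σ_e deg e,
-- deg e being the number of inner edges sharing a triangle with e (e included). Write an edge as the
-- segment in direction j based at a lattice point p of the triangle of side n − 1. An inner edge lies in
-- exactly two unit triangles: the upward one at p, whose inner sides are the c(p) inner edges based at p,
-- and a downward one, all of whose sides are inner; hence deg e = c(p) + 2. There are three points with
-- c = 1 (the corners), 3(n − 2) with c = 2 and T(n − 2) with c = 3 (T the triangular numbers), so with
-- n = k + 2 we get M = 3 + 6k + 3T(k) and Σ deg = 9 + 24k + 15T(k), whence P = 3(n − 1)².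
module Submission where

open import Defs
open import Data.Nat using (ℕ; zero; suc; _+_; _*_; _∸_; _^_; _≤_; _<_; z≤n; s≤s; _≡ᵇ_; _/_)
open import Data.Nat.DivMod using (m*n/n≡m)
open import Data.Nat.Properties
open import Data.Nat.Combinatorics using (_C_; nCk+nC[k+1]≡[n+1]C[k+1]; nC1≡n)
open import Data.Nat.Solver using (module +-*-Solver)
open import Data.Bool using (Bool; true; false; _∧_; _∨_; not; T)
open import Data.Bool.Properties using (T?; T-∧; T-∨; T-≡; T-not-≡; ∧-comm; ∧-idem; ∧-zeroʳ; ∨-identityʳ)
open import Data.Bool.ListAction using (any; or)
open import Data.List using (List; []; _∷_; _++_; map; concatMap; filter; length; upTo; applyUpTo)
open import Data.List.Properties using (filter-++; length-++; map-cong)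
open import Data.List.Relation.Unary.All using (All; []; _∷_)
import Data.List.Relation.Unary.All.Properties as All
open import Data.List.Relation.Unary.Any using (Any; satisfied)
import Data.List.Relation.Unary.Any.Properties as Any
open import Data.Product using (_×_; _,_; proj₁; proj₂; ∃)
open import Data.Sum using (_⊎_; inj₁; inj₂; reduce)
open import Data.Sum.Function.Propositional using (_⊎-⇔_)
open import Function using (_∘_; Equivalence; _⇔_; mk⇔)
open import Function.Properties.Equivalence using () renaming (trans to ⇔-trans; sym to ⇔-sym)
open import Data.Empty using (⊥; ⊥-elim)
open import Relation.Nullary.Decidable using (Dec; yes; no)
open import Relation.Nullary.Negation using (contradiction)
open import Relation.Binary.Definitions using (DecidableEquality)
open import Relation.Binary.PropositionalEquality hiding ([_])
open +-*-Solver
open import Algebra.Properties.CommutativeSemigroup +-commutativeSemigroup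
  using () renaming (interchange to +-interchange)

T-∧-intro : ∀ {a b} → T a → T b → T (a ∧ b)
T-∧-intro {true} _ tb = tb

T-∧-elim : ∀ a {b} → T (a ∧ b) → T a × T b
T-∧-elim a = Equivalence.to (T-∧ {a})

T-∨-introˡ : ∀ {a} b → T a → T (a ∨ b)
T-∨-introˡ {true} b _ = _

T-∨-introʳ : ∀ a {b} → T b → T (a ∨ b)
T-∨-introʳ true  _  = _
T-∨-introʳ false tb = tb

[_] : Bool → ℕ
[ true ]  = 1
[ false ] = 0

T⇒[]≡1 : ∀ {b} → T b → [ b ] ≡ 1
T⇒[]≡1 {true} _ = refl

[]-cong : ∀ {a b} → T a ⇔ T b → [ a ] ≡ [ b ]
[]-cong {false} {false} _ = refl
[]-cong {false} {true}  a⇔b = ⊥-elim (Equivalence.from a⇔b _)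
[]-cong {true}  {false} a⇔b = ⊥-elim (Equivalence.to a⇔b _)
[]-cong {true}  {true}  _ = refl

[∨]-disjoint : ∀ a b → (T a → T b → ⊥) → [ a ∨ b ] ≡ [ a ] + [ b ]
[∨]-disjoint true  true  a∧b⇒⊥ = ⊥-elim (a∧b⇒⊥ _ _)
[∨]-disjoint true  false _ = refl
[∨]-disjoint false b     _ = refl

<⇒≡ᵇ-false : ∀ {x y} → x < y → (x ≡ᵇ y) ≡ false
<⇒≡ᵇ-false {x} {y} x<y with x ≡ᵇ y in eq
... | true  = contradiction (≡ᵇ⇒≡ x y (subst T (sym eq) _)) (<⇒≢ x<y)
... | false = refl

≡ᵇ-consecutive : ∀ s m → (s ≡ᵇ suc m) ∧ (s ≡ᵇ m) ≡ false
≡ᵇ-consecutive zero          m       = refl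
≡ᵇ-consecutive (suc zero)    zero    = refl
≡ᵇ-consecutive (suc (suc s)) zero    = refl
≡ᵇ-consecutive (suc s)       (suc m) = ≡ᵇ-consecutive s m

+-≡ᵇ-cancelˡ : ∀ a b c → (a + b ≡ᵇ a + c) ≡ (b ≡ᵇ c)
+-≡ᵇ-cancelˡ zero    b c = refl
+-≡ᵇ-cancelˡ (suc a) b c = +-≡ᵇ-cancelˡ a b c

+-≡ᵇ-shift : ∀ a b {m} → a ≤ m → (a + b ≡ᵇ m) ≡ (b ≡ᵇ m ∸ a)
+-≡ᵇ-shift a b {m} a≤m = trans (cong (a + b ≡ᵇ_) (sym (m+[n∸m]≡n a≤m))) (+-≡ᵇ-cancelˡ a b (m ∸ a))

∑ : {A : Set} → (A → ℕ) → List A → ℕ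
∑ f []       = 0
∑ f (x ∷ xs) = f x + ∑ f xs

count : {A : Set} → (A → Bool) → List A → ℕ
count P = ∑ (λ x → [ P x ])

module _ {A : Set} where

  ∑-cong : {f g : A → ℕ} (xs : List A) → (∀ x → f x ≡ g x) → ∑ f xs ≡ ∑ g xs
  ∑-cong []       f≡g = refl
  ∑-cong (x ∷ xs) f≡g = cong₂ _+_ (f≡g x) (∑-cong xs f≡g)

  ∑-congᴬ : {P : A → Set} {f g : A → ℕ} {xs : List A} →
            All P xs → (∀ {x} → P x → f x ≡ g x) → ∑ f xs ≡ ∑ g xs
  ∑-congᴬ []         f≡g = refl
  ∑-congᴬ (px ∷ pxs) f≡g = cong₂ _+_ (f≡g px) (∑-congᴬ pxs f≡g)

  ∑-++ : (f : A → ℕ) (xs ys : List A) → ∑ f (xs ++ ys) ≡ ∑ f xs + ∑ f ys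
  ∑-++ f []       ys = refl
  ∑-++ f (x ∷ xs) ys = trans (cong (f x +_) (∑-++ f xs ys)) (sym (+-assoc (f x) _ _))

  ∑-zero : (xs : List A) → ∑ (λ _ → 0) xs ≡ 0
  ∑-zero []       = refl
  ∑-zero (x ∷ xs) = ∑-zero xs

  ∑-+ : (f g : A → ℕ) (xs : List A) → ∑ (λ x → f x + g x) xs ≡ ∑ f xs + ∑ g xs
  ∑-+ f g []       = refl
  ∑-+ f g (x ∷ xs) = trans (cong (f x + g x +_) (∑-+ f g xs)) (+-interchange (f x) (g x) _ _)

  ∑-*ʳ : (f : A → ℕ) (k : ℕ) (xs : List A) → ∑ (λ x → f x * k) xs ≡ ∑ f xs * k
  ∑-*ʳ f k []       = refl
  ∑-*ʳ f k (x ∷ xs) = trans (cong (f x * k +_) (∑-*ʳ f k xs)) (sym (*-distribʳ-+ k (f x) _))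

  ∑-*ˡ : (k : ℕ) (f : A → ℕ) (xs : List A) → ∑ (λ x → k * f x) xs ≡ k * ∑ f xs
  ∑-*ˡ k f []       = sym (*-zeroʳ k)
  ∑-*ˡ k f (x ∷ xs) = trans (cong (k * f x +_) (∑-*ˡ k f xs)) (sym (*-distribˡ-+ k (f x) _))

  length≡∑1 : (xs : List A) → length xs ≡ ∑ (λ _ → 1) xs
  length≡∑1 []       = refl
  length≡∑1 (x ∷ xs) = cong suc (length≡∑1 xs)

  ∑-filter : (f : A → ℕ) (P : A → Bool) (xs : List A) →
             ∑ f (filter (T? ∘ P) xs) ≡ ∑ (λ x → [ P x ] * f x) xs
  ∑-filter f P []       = refl
  ∑-filter f P (x ∷ xs) with P x
  ... | true  = cong₂ _+_ (sym (+-identityʳ (f x))) (∑-filter f P xs)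
  ... | false = ∑-filter f P xs

module _ {A B : Set} where

  ∑-map : (f : B → ℕ) (g : A → B) (xs : List A) → ∑ f (map g xs) ≡ ∑ (f ∘ g) xs
  ∑-map f g []       = refl
  ∑-map f g (x ∷ xs) = cong (f (g x) +_) (∑-map f g xs)

  ∑-concatMap : (f : B → ℕ) (g : A → List B) (xs : List A) →
                ∑ f (concatMap g xs) ≡ ∑ (λ x → ∑ f (g x)) xs
  ∑-concatMap f g []       = refl
  ∑-concatMap f g (x ∷ xs) = trans (∑-++ f (g x) (concatMap g xs)) (cong (∑ f (g x) +_) (∑-concatMap f g xs))

  ∑-comm : (f : A → B → ℕ) (xs : List A) (ys : List B) →
           ∑ (λ x → ∑ (f x) ys) xs ≡ ∑ (λ y → ∑ (λ x → f x y) xs) ys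
  ∑-comm f []       ys = sym (∑-zero ys)
  ∑-comm f (x ∷ xs) ys = trans (cong (∑ (f x) ys +_) (∑-comm f xs ys)) (sym (∑-+ (f x) _ ys))

module _ {A : Set} where

  countPairs : (A → A → Bool) → List A → ℕ
  countPairs R []       = 0
  countPairs R (x ∷ xs) = count (R x) xs + countPairs R xs

  count-not : (P : A → Bool) (xs : List A) → count (not ∘ P) xs + count P xs ≡ length xs
  count-not P []       = refl
  count-not P (x ∷ xs) with P x
  ... | true  = trans (+-suc _ _) (cong suc (count-not P xs))
  ... | false = cong suc (count-not P xs)

  countPairs-complement : (R : A → A → Bool) (xs : List A) →
    countPairs (λ x y → not (R x y)) xs + countPairs R xs ≡ length xs C 2
  countPairs-complement R []       = refl
  countPairs-complement R (x ∷ xs) = begin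
    (c̄ + p̄) + (c + p)  ≡⟨ +-interchange c̄ p̄ c p ⟩
    (c̄ + c) + (p̄ + p)  ≡⟨ cong₂ _+_ (count-not (R x) xs) (countPairs-complement R xs) ⟩
    length xs + length xs C 2      ≡⟨ cong (_+ length xs C 2) (nC1≡n (length xs)) ⟨
    length xs C 1 + length xs C 2  ≡⟨ nCk+nC[k+1]≡[n+1]C[k+1] (length xs) 1 ⟩
    suc (length xs) C 2            ∎
    where
    open ≡-Reasoning
    c̄ p̄ c p : ℕ
    c̄ = count (λ y → not (R x y)) xs
    p̄ = countPairs (λ x y → not (R x y)) xs
    c = count (R x) xs
    p = countPairs R xs

  countPairs-handshake : (R : A → A → Bool) → (∀ x y → R x y ≡ R y x) → (xs : List A) →
    2 * countPairs R xs + count (λ x → R x x) xs ≡ ∑ (λ x → count (R x) xs) xs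
  countPairs-handshake R sym-R []       = refl
  countPairs-handshake R sym-R (x ∷ xs) = begin
    2 * (c + p) + ([ R x x ] + d)                       ≡⟨ solve 4 (λ c p r d → con 2 :* (c :+ p) :+ (r :+ d) := (r :+ c) :+ (c :+ (con 2 :* p :+ d))) refl c p [ R x x ] d ⟩
    ([ R x x ] + c) + (c + (2 * p + d))                 ≡⟨ cong (λ z → [ R x x ] + c + (z + (2 * p + d))) c≡c′ ⟩
    ([ R x x ] + c) + (c′ + (2 * p + d))                ≡⟨ cong (λ z → [ R x x ] + c + (c′ + z)) (countPairs-handshake R sym-R xs) ⟩
    ([ R x x ] + c) + (c′ + ∑ (λ y → count (R y) xs) xs) ≡⟨ cong ([ R x x ] + c +_) (∑-+ (λ y → [ R y x ]) (λ y → count (R y) xs) xs) ⟨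
    ([ R x x ] + c) + ∑ (λ y → [ R y x ] + count (R y) xs) xs ∎
    where
    open ≡-Reasoning
    c c′ p d : ℕ
    c = count (R x) xs
    c′ = count (λ y → R y x) xs
    p = countPairs R xs
    d = count (λ x → R x x) xs
    c≡c′ : c ≡ c′
    c≡c′ = ∑-cong xs (λ y → cong [_] (sym-R x y))

twice-C₂ : ∀ n → 2 * (n C 2) + n ≡ n * n
twice-C₂ zero    = refl
twice-C₂ (suc n) = begin
  2 * (suc n C 2) + suc n          ≡⟨ cong (λ c → 2 * c + suc n) (nCk+nC[k+1]≡[n+1]C[k+1] n 1) ⟨
  2 * (n C 1 + n C 2) + suc n      ≡⟨ cong (λ c → 2 * (c + n C 2) + suc n) (nC1≡n n) ⟩
  2 * (n + n C 2) + suc n          ≡⟨ solve 2 (λ n c → con 2 :* (n :+ c) :+ (con 1 :+ n) := (con 2 :* c :+ n) :+ (con 2 :* n :+ con 1)) refl n (n C 2) ⟩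
  (2 * (n C 2) + n) + (2 * n + 1)  ≡⟨ cong (_+ (2 * n + 1)) (twice-C₂ n) ⟩
  n * n + (2 * n + 1)              ≡⟨ solve 1 (λ n → n :* n :+ (con 2 :* n :+ con 1) := (con 1 :+ n) :* (con 1 :+ n)) refl n ⟩
  suc n * suc n                    ∎
  where open ≡-Reasoning

subsetsOfSize-1 : {A : Set} (xs : List A) → subsetsOfSize 1 xs ≡ map (_∷ []) xs
subsetsOfSize-1 []       = refl
subsetsOfSize-1 (x ∷ xs) = cong ((x ∷ []) ∷_) (subsetsOfSize-1 xs)

L-2≡countPairs : ∀ n → L n 2 ≡ countPairs (λ e f → not (shareTriangle n e f)) (innerEdges n)
L-2≡countPairs n = admissiblePairs (innerEdges n)
  where
  admissible? : (s : List Edge) → Dec (T (admissible n s))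
  admissible? s = T? (admissible n s)

  admissibleWith : ∀ e fs → length (filter admissible? (map (e ∷_) (map (_∷ []) fs)))
                          ≡ count (λ f → not (shareTriangle n e f)) fs
  admissibleWith e []       = refl
  admissibleWith e (f ∷ fs) with shareTriangle n e f
  ... | true  = admissibleWith e fs
  ... | false = cong suc (admissibleWith e fs)

  admissiblePairs : ∀ es → length (filter admissible? (subsetsOfSize 2 es))
                         ≡ countPairs (λ e f → not (shareTriangle n e f)) es
  admissiblePairs []       = refl
  admissiblePairs (e ∷ es) rewrite subsetsOfSize-1 es = begin
    length (filter admissible? (withE ++ withoutE))                   ≡⟨ cong length (filter-++ admissible? withE withoutE) ⟩
    length (filter admissible? withE ++ filter admissible? withoutE)  ≡⟨ length-++ (filter admissible? withE) ⟩
    length (filter admissible? withE) + length (filter admissible? withoutE)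
      ≡⟨ cong₂ _+_ (admissibleWith e es) (admissiblePairs es) ⟩
    countPairs (λ e f → not (shareTriangle n e f)) (e ∷ es)           ∎
    where
    open ≡-Reasoning
    withE withoutE : List (List Edge)
    withE    = map (e ∷_) (map (_∷ []) es)
    withoutE = subsetsOfSize 2 es

sumTo : ℕ → (ℕ → ℕ) → ℕ
sumTo zero    f = 0
sumTo (suc N) f = f 0 + sumTo N (f ∘ suc)

∑-applyUpTo : (f h : ℕ → ℕ) (N : ℕ) → ∑ f (applyUpTo h N) ≡ sumTo N (f ∘ h)
∑-applyUpTo f h zero    = refl
∑-applyUpTo f h (suc N) = cong (f (h 0) +_) (∑-applyUpTo f (h ∘ suc) N)

sumTo-cong : ∀ N {f g : ℕ → ℕ} → (∀ {i} → i < N → f i ≡ g i) → sumTo N f ≡ sumTo N g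
sumTo-cong zero    f≡g = refl
sumTo-cong (suc N) f≡g = cong₂ _+_ (f≡g (s≤s z≤n)) (sumTo-cong N (f≡g ∘ s≤s))

sumTo-zero : ∀ N {f : ℕ → ℕ} → (∀ i → f i ≡ 0) → sumTo N f ≡ 0
sumTo-zero zero    f≡0 = refl
sumTo-zero (suc N) f≡0 = cong₂ _+_ (f≡0 0) (sumTo-zero N (f≡0 ∘ suc))

sumTo-const : ∀ N c → sumTo N (λ _ → c) ≡ N * c
sumTo-const zero    c = refl
sumTo-const (suc N) c = cong (c +_) (sumTo-const N c)

sumTo-snoc : ∀ N f → sumTo (suc N) f ≡ sumTo N f + f N
sumTo-snoc zero    f = +-comm (f 0) 0
sumTo-snoc (suc N) f = trans (cong (f 0 +_) (sumTo-snoc N (f ∘ suc))) (sym (+-assoc (f 0) _ _))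

sumTo-reverse : ∀ N f → sumTo N (λ i → f (N ∸ suc i)) ≡ sumTo N f
sumTo-reverse zero    f = refl
sumTo-reverse (suc N) f = begin
  f N + sumTo N (λ i → f (N ∸ suc i)) ≡⟨ +-comm (f N) _ ⟩
  sumTo N (λ i → f (N ∸ suc i)) + f N ≡⟨ cong (_+ f N) (sumTo-reverse N f) ⟩
  sumTo N f + f N                     ≡⟨ sumTo-snoc N f ⟨
  sumTo (suc N) f                     ∎
  where open ≡-Reasoning

sumTo-indicator : ∀ N (f : ℕ → ℕ) {x} → x < N → sumTo N (λ i → f i * [ i ≡ᵇ x ]) ≡ f x
sumTo-indicator (suc N) f {zero} _ =
  trans (cong₂ _+_ (*-identityʳ (f 0)) (sumTo-zero N (λ i → *-zeroʳ (f (suc i))))) (+-identityʳ (f 0))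
sumTo-indicator (suc N) f {suc x} (s≤s x<N) =
  trans (cong (_+ sumTo N (λ i → f (suc i) * [ i ≡ᵇ x ])) (*-zeroʳ (f 0))) (sumTo-indicator N (f ∘ suc) x<N)

InTri : ℕ → Point → Set
InTri m (a , b) = a + b ≤ m

row-bound : ∀ {m a b} → a < suc m → b < suc (m ∸ a) → a + b ≤ m
row-bound {m} {a} a<1+m b<1+m∸a = ≤-trans (+-monoʳ-≤ a (≤-pred b<1+m∸a)) (≤-reflexive (m+[n∸m]≡n (≤-pred a<1+m)))

row-bound⁻ : ∀ {m a b} → a + b ≤ m → a < suc m × b < suc (m ∸ a)
row-bound⁻ {m} {a} {b} a+b≤m =
  s≤s (≤-trans (m≤m+n a b) a+b≤m) , s≤s (m+n≤o⇒m≤o∸n b (subst (_≤ m) (+-comm a b) a+b≤m))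

∑-pts : (g : Point → ℕ) (m : ℕ) → ∑ g (pts m) ≡ sumTo (suc m) (λ a → sumTo (suc (m ∸ a)) (λ b → g (a , b)))
∑-pts g m = begin
  ∑ g (pts m)                                               ≡⟨ ∑-concatMap g row (upTo (suc m)) ⟩
  ∑ (λ a → ∑ g (row a)) (upTo (suc m))                      ≡⟨ ∑-applyUpTo _ (λ a → a) (suc m) ⟩
  sumTo (suc m) (λ a → ∑ g (row a))                         ≡⟨ sumTo-cong (suc m) (λ {a} _ → ∑-row a) ⟩
  sumTo (suc m) (λ a → sumTo (suc (m ∸ a)) (λ b → g (a , b))) ∎
  where
  open ≡-Reasoning
  row : ℕ → List Point
  row a = map (a ,_) (upTo (suc (m ∸ a)))
  ∑-row : ∀ a → ∑ g (row a) ≡ sumTo (suc (m ∸ a)) (λ b → g (a , b))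
  ∑-row a = trans (∑-map g (a ,_) (upTo (suc (m ∸ a)))) (∑-applyUpTo _ (λ b → b) (suc (m ∸ a)))

pts-inside : ∀ m → All (InTri m) (pts m)
pts-inside m = All.concat⁺ (All.map⁺ {f = row} (All.applyUpTo⁺₁ (λ a → a) (suc m) (λ a<1+m →
  All.map⁺ {f = _ ,_} (All.applyUpTo⁺₁ (λ b → b) _ (row-bound a<1+m)))))
  where
  row : ℕ → List Point
  row a = map (a ,_) (upTo (suc (m ∸ a)))

pts⁺ : ∀ {P : Point → Set} {m a b} → a + b ≤ m → P (a , b) → Any P (pts m)
pts⁺ {P} {m} {a} {b} a+b≤m Pab with row-bound⁻ {m} {a} {b} a+b≤m
... | a<1+m , b<1+m∸a =
  Any.concatMap⁺ (λ x → map (x ,_) (upTo (suc (m ∸ x))))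
    (Any.applyUpTo⁺ (λ x → x) (Any.map⁺ (Any.applyUpTo⁺ (λ y → y) Pab b<1+m∸a)) a<1+m)

∑-pts-indicator : ∀ m (g : Point → ℕ) {u} → InTri m u → ∑ (λ q → g q * [ q ==ₚ u ]) (pts m) ≡ g u
∑-pts-indicator m g {x , y} x+y≤m with row-bound⁻ {m} {x} {y} x+y≤m
... | x<1+m , y<1+m∸x = begin
  ∑ (λ q → g q * [ q ==ₚ (x , y) ]) (pts m)
    ≡⟨ ∑-pts _ m ⟩
  sumTo (suc m) (λ a → sumTo (suc (m ∸ a)) (λ b → g (a , b) * [ (a ≡ᵇ x) ∧ (b ≡ᵇ y) ]))
    ≡⟨ sumTo-cong (suc m) (λ {a} _ → factor a) ⟩
  sumTo (suc m) (λ a → sumTo (suc (m ∸ a)) (λ b → g (a , b) * [ b ≡ᵇ y ]) * [ a ≡ᵇ x ])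
    ≡⟨ sumTo-indicator (suc m) (λ a → sumTo (suc (m ∸ a)) (λ b → g (a , b) * [ b ≡ᵇ y ])) x<1+m ⟩
  sumTo (suc (m ∸ x)) (λ b → g (x , b) * [ b ≡ᵇ y ])
    ≡⟨ sumTo-indicator (suc (m ∸ x)) (λ b → g (x , b)) y<1+m∸x ⟩
  g (x , y) ∎
  where
  open ≡-Reasoning
  factor : ∀ a → sumTo (suc (m ∸ a)) (λ b → g (a , b) * [ (a ≡ᵇ x) ∧ (b ≡ᵇ y) ])
               ≡ sumTo (suc (m ∸ a)) (λ b → g (a , b) * [ b ≡ᵇ y ]) * [ a ≡ᵇ x ]
  factor a with a ≡ᵇ x
  ... | true  = sym (*-identityʳ _)
  ... | false = trans (sumTo-zero (suc (m ∸ a)) (λ b → *-zeroʳ (g (a , b))))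
                      (sym (*-zeroʳ (sumTo (suc (m ∸ a)) (λ b → g (a , b) * [ b ≡ᵇ y ]))))

==ₚ⇒≡ : ∀ p q → T (p ==ₚ q) → p ≡ q
==ₚ⇒≡ (a , b) (c , d) eq with T-∧-elim (a ≡ᵇ c) eq
... | a≡c , b≡d = cong₂ _,_ (≡ᵇ⇒≡ a c a≡c) (≡ᵇ⇒≡ b d b≡d)

==ₚ-refl : ∀ p → T (p ==ₚ p)
==ₚ-refl (a , b) = T-∧-intro (≡⇒≡ᵇ a a refl) (≡⇒≡ᵇ b b refl)

==ₚ⇔≡ : ∀ p q → T (p ==ₚ q) ⇔ p ≡ q
==ₚ⇔≡ p q = mk⇔ (==ₚ⇒≡ p q) (λ { refl → ==ₚ-refl p })

multiplicity : Point → List Point → ℕ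
multiplicity q = count (q ==ₚ_)

∑-pts-multiplicity : ∀ m (g : Point → ℕ) {us} → All (InTri m) us →
  ∑ (λ q → g q * multiplicity q us) (pts m) ≡ ∑ g us
∑-pts-multiplicity m g {us} us-inside = begin
  ∑ (λ q → g q * multiplicity q us) (pts m)         ≡⟨ ∑-cong (pts m) (λ q → ∑-*ˡ (g q) _ us) ⟨
  ∑ (λ q → ∑ (λ u → g q * [ q ==ₚ u ]) us) (pts m)  ≡⟨ ∑-comm (λ q u → g q * [ q ==ₚ u ]) (pts m) us ⟩
  ∑ (λ u → ∑ (λ q → g q * [ q ==ₚ u ]) (pts m)) us  ≡⟨ ∑-congᴬ us-inside (∑-pts-indicator m g) ⟩
  ∑ g us                                            ∎
  where open ≡-Reasoning

[]≡multiplicity-single : ∀ {b} q u → T b ⇔ (q ≡ u ⊎ q ≡ u) → [ b ] ≡ multiplicity q (u ∷ [])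
[]≡multiplicity-single q u b⇔ =
  trans ([]-cong (⇔-trans b⇔ (⇔-trans (mk⇔ reduce inj₁) (⇔-sym (==ₚ⇔≡ q u))))) (sym (+-identityʳ _))

[]≡multiplicity-pair : ∀ {b} q u v → u ≢ v → T b ⇔ (q ≡ u ⊎ q ≡ v) → [ b ] ≡ multiplicity q (u ∷ v ∷ [])
[]≡multiplicity-pair {b} q u v u≢v b⇔ = begin
  [ b ]                        ≡⟨ []-cong (⇔-trans b⇔ (⇔-sym (⇔-trans (T-∨ {q ==ₚ u}) (==ₚ⇔≡ q u ⊎-⇔ ==ₚ⇔≡ q v)))) ⟩
  [ (q ==ₚ u) ∨ (q ==ₚ v) ]    ≡⟨ [∨]-disjoint (q ==ₚ u) (q ==ₚ v) (λ q=u q=v → u≢v (trans (sym (==ₚ⇒≡ q u q=u)) (==ₚ⇒≡ q v q=v))) ⟩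
  [ q ==ₚ u ] + [ q ==ₚ v ]    ≡⟨ cong ([ q ==ₚ u ] +_) (+-identityʳ [ q ==ₚ v ]) ⟨
  multiplicity q (u ∷ v ∷ [])  ∎
  where open ≡-Reasoning

data Side : Set where
  side₁ side₂ side₃ : Side

_≟ˢ_ : DecidableEquality Side
side₁ ≟ˢ side₁ = yes refl
side₂ ≟ˢ side₂ = yes refl
side₃ ≟ˢ side₃ = yes refl
side₁ ≟ˢ side₂ = no λ ()
side₁ ≟ˢ side₃ = no λ ()
side₂ ≟ˢ side₁ = no λ ()
side₂ ≟ˢ side₃ = no λ ()
side₃ ≟ˢ side₁ = no λ ()
side₃ ≟ˢ side₂ = no λ ()

-- The order in which `edges` lists the three edges based at a point.
sides : List Side
sides = side₂ ∷ side₁ ∷ side₃ ∷ []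

-- edge j p is the unit segment based at p parallel to side j of the big triangle
-- (side₁ : a = 0, side₂ : b = 0, side₃ : a + b = n).
edge : Side → Point → Edge
edge side₁ (a , b) = (a , b) , (a , suc b)
edge side₂ (a , b) = (a , b) , (suc a , b)
edge side₃ (a , b) = (suc a , b) , (a , suc b)

up down : Point → UTri
up   (a , b) = (a , b) , (suc a , b) , (a , suc b)
down (a , b) = (suc a , b) , (a , suc b) , (suc a , suc b)

downBase : Side → Point → Point
downBase side₁ (a , b) = suc a , b
downBase side₂ (a , b) = a , suc b
downBase side₃ r       = r

data _∈△_ : Point → UTri → Set where
  vertex₁ : ∀ {u v w} → u ∈△ (u , v , w)
  vertex₂ : ∀ {u v w} → v ∈△ (u , v , w)
  vertex₃ : ∀ {u v w} → w ∈△ (u , v , w)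

isVertexOf⇒∈△ : ∀ p t → T (isVertexOf p t) → p ∈△ t
isVertexOf⇒∈△ p (u , v , w) h with Equivalence.to T-∨ h
... | inj₁ p=u = subst (_∈△ _) (sym (==ₚ⇒≡ p u p=u)) vertex₁
... | inj₂ h′ with Equivalence.to T-∨ h′
... | inj₁ p=v = subst (_∈△ _) (sym (==ₚ⇒≡ p v p=v)) vertex₂
... | inj₂ p=w = subst (_∈△ _) (sym (==ₚ⇒≡ p w p=w)) vertex₃

∈△⇒isVertexOf : ∀ {p t} → p ∈△ t → T (isVertexOf p t)
∈△⇒isVertexOf {p} {u , v , w} vertex₁ = T-∨-introˡ _ (==ₚ-refl p)
∈△⇒isVertexOf {p} {u , v , w} vertex₂ = T-∨-introʳ (p ==ₚ u) (T-∨-introˡ _ (==ₚ-refl p))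
∈△⇒isVertexOf {p} {u , v , w} vertex₃ = T-∨-introʳ (p ==ₚ u) (T-∨-introʳ (p ==ₚ v) (==ₚ-refl p))

isSideOf⇒∈△ : ∀ p q t → T (isSideOf (p , q) t) → p ∈△ t × q ∈△ t
isSideOf⇒∈△ p q t h with T-∧-elim (isVertexOf p t) h
... | p∈t , q∈t = isVertexOf⇒∈△ p t p∈t , isVertexOf⇒∈△ q t q∈t

∈△⇒isSideOf : ∀ {p q t} → p ∈△ t → q ∈△ t → T (isSideOf (p , q) t)
∈△⇒isSideOf p∈t q∈t = T-∧-intro (∈△⇒isVertexOf p∈t) (∈△⇒isVertexOf q∈t)

sideOf-up⁻ : ∀ k {q r} → T (isSideOf (edge k q) (up r)) → q ≡ r
sideOf-up⁻ k {q} {r} h = base k (isSideOf⇒∈△ _ _ (up r) h)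
  where
  base : ∀ k {q} → proj₁ (edge k q) ∈△ up r × proj₂ (edge k q) ∈△ up r → q ≡ r
  base side₁ (vertex₁ , vertex₃) = refl
  base side₂ (vertex₁ , vertex₂) = refl
  base side₃ (vertex₂ , vertex₃) = refl

sideOf-down⁻ : ∀ k {q r} → T (isSideOf (edge k q) (down r)) → q ≡ downBase k r
sideOf-down⁻ k {q} {r} h = base k (isSideOf⇒∈△ _ _ (down r) h)
  where
  base : ∀ k {q} → proj₁ (edge k q) ∈△ down r × proj₂ (edge k q) ∈△ down r → q ≡ downBase k r
  base side₁ (vertex₁ , vertex₃) = refl
  base side₂ (vertex₂ , vertex₃) = refl
  base side₃ (vertex₁ , vertex₂) = refl

sideOf-up : ∀ k r → T (isSideOf (edge k r) (up r))
sideOf-up side₁ r = ∈△⇒isSideOf {t = up r} vertex₁ vertex₃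
sideOf-up side₂ r = ∈△⇒isSideOf {t = up r} vertex₁ vertex₂
sideOf-up side₃ r = ∈△⇒isSideOf {t = up r} vertex₂ vertex₃

sideOf-down : ∀ k r → T (isSideOf (edge k (downBase k r)) (down r))
sideOf-down side₁ r = ∈△⇒isSideOf {t = down r} vertex₁ vertex₃
sideOf-down side₂ r = ∈△⇒isSideOf {t = down r} vertex₂ vertex₃
sideOf-down side₃ r = ∈△⇒isSideOf {t = down r} vertex₁ vertex₂

triangle⁻ : ∀ n (P : UTri → Bool) → T (any P (unitTriangles n)) →
  (∃ λ r → T (P (up r))) ⊎ (∃ λ r → T (P (down r)))
triangle⁻ (suc zero) P h with Any.++⁻ (map up (pts 0)) (Any.any⁻ P (map up (pts 0) ++ []) h)
... | inj₁ at-up = inj₁ (satisfied (Any.map⁻ at-up))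
... | inj₂ ()
triangle⁻ (suc (suc m)) P h with Any.++⁻ (map up (pts (suc m))) (Any.any⁻ P (unitTriangles (suc (suc m))) h)
... | inj₁ at-up   = inj₁ (satisfied (Any.map⁻ at-up))
... | inj₂ at-down = inj₂ (satisfied (Any.map⁻ at-down))

up-triangle : ∀ m (P : UTri → Bool) {r} → InTri m r → T (P (up r)) → T (any P (unitTriangles (suc m)))
up-triangle m P r-inside Pr = Any.any⁺ P (Any.++⁺ˡ (Any.map⁺ (pts⁺ r-inside Pr)))

down-triangle : ∀ m (P : UTri → Bool) {r} → InTri m r → T (P (down r)) →
  T (any P (unitTriangles (suc (suc m))))
down-triangle m P r-inside Pr = Any.any⁺ P (Any.++⁺ʳ (map up (pts (suc m))) (Any.map⁺ (pts⁺ r-inside Pr)))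

shareTriangle-sym : ∀ n e f → shareTriangle n e f ≡ shareTriangle n f e
shareTriangle-sym n e f = cong or (map-cong (λ t → ∧-comm (isSideOf e t) (isSideOf f t)) (unitTriangles n))

shareTriangle⁻ : ∀ n j k {p q} → T (shareTriangle n (edge j p) (edge k q)) →
  q ≡ p ⊎ ∃ λ r → p ≡ downBase j r × q ≡ downBase k r
shareTriangle⁻ n j k {p} {q} h with triangle⁻ n (λ t → isSideOf (edge j p) t ∧ isSideOf (edge k q) t) h
... | inj₁ (r , at-up) with T-∧-elim (isSideOf (edge j p) (up r)) at-up
...   | p-side , q-side = inj₁ (trans (sideOf-up⁻ k q-side) (sym (sideOf-up⁻ j p-side)))
shareTriangle⁻ n j k {p} {q} h | inj₂ (r , at-down) with T-∧-elim (isSideOf (edge j p) (down r)) at-down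
...   | p-side , q-side = inj₂ (r , sideOf-down⁻ j p-side , sideOf-down⁻ k q-side)

shareTriangle-up : ∀ m j k {p} → InTri m p → T (shareTriangle (suc m) (edge j p) (edge k p))
shareTriangle-up m j k {p} p-inside =
  up-triangle m (λ t → isSideOf (edge j p) t ∧ isSideOf (edge k p) t) p-inside
    (T-∧-intro (sideOf-up j p) (sideOf-up k p))

shareTriangle-down : ∀ m j k {r} → InTri m r →
  T (shareTriangle (suc (suc m)) (edge j (downBase j r)) (edge k (downBase k r)))
shareTriangle-down m j k {r} r-inside =
  down-triangle m (λ t → isSideOf (edge j (downBase j r)) t ∧ isSideOf (edge k (downBase k r)) t) r-inside
    (T-∧-intro (sideOf-down j r) (sideOf-down k r))

offSide : ℕ → Side → Point → Bool
offSide m side₁ (a , b) = not (a ≡ᵇ 0)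
offSide m side₂ (a , b) = not (b ≡ᵇ 0)
offSide m side₃ (a , b) = not (a + b ≡ᵇ m)

innerCount : ℕ → Point → ℕ
innerCount m p = ∑ (λ j → [ offSide m j p ]) sides

inner⇔offSide : ∀ m j p → not (onBoundary (suc m) (edge j p)) ≡ offSide m j p
inner⇔offSide m side₁ (a , b)
  rewrite +-suc a b | ∧-idem (a ≡ᵇ 0) | ∧-zeroʳ (b ≡ᵇ 0) | ≡ᵇ-consecutive (a + b) m | ∨-identityʳ (a ≡ᵇ 0) = refl
inner⇔offSide m side₂ (a , b)
  rewrite ∧-zeroʳ (a ≡ᵇ 0) | ∧-idem (b ≡ᵇ 0) | ≡ᵇ-consecutive (a + b) m | ∨-identityʳ (b ≡ᵇ 0) = refl
inner⇔offSide m side₃ (a , b)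
  rewrite +-suc a b | ∧-zeroʳ (b ≡ᵇ 0) | ∧-idem (a + b ≡ᵇ m) = refl

∑-innerEdges : ∀ m (f : Edge → ℕ) →
  ∑ f (innerEdges (suc m)) ≡ ∑ (λ p → ∑ (λ j → [ offSide m j p ] * f (edge j p)) sides) (pts m)
∑-innerEdges m f = begin
  ∑ f (innerEdges (suc m))
    ≡⟨ ∑-filter f (not ∘ onBoundary (suc m)) (edges (suc m)) ⟩
  ∑ (λ e → [ not (onBoundary (suc m) e) ] * f e) (edges (suc m))
    ≡⟨ ∑-concatMap (λ e → [ not (onBoundary (suc m) e) ] * f e) (λ p → map (λ j → edge j p) sides) (pts m) ⟩
  ∑ (λ p → ∑ (λ j → [ not (onBoundary (suc m) (edge j p)) ] * f (edge j p)) sides) (pts m)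
    ≡⟨ ∑-cong (pts m) (λ p → ∑-cong sides (λ j → cong (λ b → [ b ] * f (edge j p)) (inner⇔offSide m j p))) ⟩
  ∑ (λ p → ∑ (λ j → [ offSide m j p ] * f (edge j p)) sides) (pts m) ∎
  where open ≡-Reasoning

length-innerEdges : ∀ m → length (innerEdges (suc m)) ≡ ∑ (innerCount m) (pts m)
length-innerEdges m =
  trans (length≡∑1 (innerEdges (suc m)))
   (trans (∑-innerEdges m (λ _ → 1))
    (∑-cong (pts m) (λ p → ∑-cong sides (λ j → *-identityʳ [ offSide m j p ]))))

count-shareTriangle-refl : ∀ m →
  count (λ e → shareTriangle (suc m) e e) (innerEdges (suc m)) ≡ length (innerEdges (suc m))
count-shareTriangle-refl m = begin
  count (λ e → shareTriangle (suc m) e e) (innerEdges (suc m))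
    ≡⟨ ∑-innerEdges m (λ e → [ shareTriangle (suc m) e e ]) ⟩
  ∑ (λ p → ∑ (λ j → [ offSide m j p ] * [ shareTriangle (suc m) (edge j p) (edge j p) ]) sides) (pts m)
    ≡⟨ ∑-congᴬ (pts-inside m) (λ {p} p-inside → ∑-cong sides (λ j →
         cong ([ offSide m j p ] *_) (T⇒[]≡1 (shareTriangle-up m j j {p} p-inside)))) ⟩
  ∑ (λ p → ∑ (λ j → [ offSide m j p ] * 1) sides) (pts m)
    ≡⟨ ∑-innerEdges m (λ _ → 1) ⟨
  ∑ (λ _ → 1) (innerEdges (suc m))
    ≡⟨ length≡∑1 (innerEdges (suc m)) ⟨
  length (innerEdges (suc m)) ∎
  where open ≡-Reasoning

downBase-injective : ∀ j {r s} → downBase j r ≡ downBase j s → r ≡ s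
downBase-injective side₁ refl = refl
downBase-injective side₂ refl = refl
downBase-injective side₃ refl = refl

downBase-injectiveˡ : ∀ j k {r} → downBase j r ≡ downBase k r → j ≡ k
downBase-injectiveˡ side₁ side₁ _ = refl
downBase-injectiveˡ side₂ side₂ _ = refl
downBase-injectiveˡ side₃ side₃ _ = refl

downBase-inside : ∀ m j {r} → InTri m r → InTri (suc m) (downBase j r)
downBase-inside m side₁ r-inside = s≤s r-inside
downBase-inside m side₂ {a , b} r-inside = subst (_≤ suc m) (sym (+-suc a b)) (s≤s r-inside)
downBase-inside m side₃ r-inside = m≤n⇒m≤1+n r-inside

offSide-inside⇒downBase : ∀ m j {p} → InTri (suc m) p → offSide (suc m) j p ≡ true →
  ∃ λ r → InTri m r × p ≡ downBase j r
offSide-inside⇒downBase m side₁ {suc a , b} p-inside _ = (a , b) , ≤-pred p-inside , refl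
offSide-inside⇒downBase m side₂ {a , suc b} p-inside _ =
  (a , b) , ≤-pred (subst (_≤ suc m) (+-suc a b) p-inside) , refl
offSide-inside⇒downBase m side₃ {a , b} p-inside off = (a , b) , ≤-pred (≤∧≢⇒< p-inside a+b≢1+m) , refl
  where
  a+b≢1+m : a + b ≢ suc m
  a+b≢1+m a+b≡1+m = subst T (Equivalence.to T-not-≡ (Equivalence.from T-≡ off)) (≡⇒≡ᵇ _ _ a+b≡1+m)

shareTriangle-downBase : ∀ m j k {r q} → InTri m r →
  T (shareTriangle (suc (suc m)) (edge j (downBase j r)) (edge k q)) ⇔ (q ≡ downBase j r ⊎ q ≡ downBase k r)
shareTriangle-downBase m j k {r} {q} r-inside = mk⇔ to from
  where
  to : T (shareTriangle (suc (suc m)) (edge j (downBase j r)) (edge k q)) → q ≡ downBase j r ⊎ q ≡ downBase k r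
  to shared with shareTriangle⁻ (suc (suc m)) j k shared
  ... | inj₁ q≡p = inj₁ q≡p
  ... | inj₂ (s , r↦s , q≡s) = inj₂ (trans q≡s (cong (downBase k) (sym (downBase-injective j r↦s))))

  from : q ≡ downBase j r ⊎ q ≡ downBase k r → T (shareTriangle (suc (suc m)) (edge j (downBase j r)) (edge k q))
  from (inj₁ refl) = shareTriangle-up (suc m) j k (downBase-inside m j r-inside)
  from (inj₂ refl) = shareTriangle-down m j k r-inside

-- sharingBases j k r lists the base points q for which edge k q shares a triangle with edge j (downBase j r):
-- those of the k-sides of up (downBase j r) and of down r, which coincide exactly when k = j.
otherSharingBase : Side → Side → Point → List Point
otherSharingBase j k r with j ≟ˢ k
... | yes _ = []
... | no  _ = downBase k r ∷ []

sharingBases : Side → Side → Point → List Point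
sharingBases j k r = downBase j r ∷ otherSharingBase j k r

shareTriangle-multiplicity : ∀ m j k {r q} → InTri m r →
  [ shareTriangle (suc (suc m)) (edge j (downBase j r)) (edge k q) ] ≡ multiplicity q (sharingBases j k r)
shareTriangle-multiplicity m j k {r} {q} r-inside with j ≟ˢ k
... | yes refl = []≡multiplicity-single q (downBase j r) (shareTriangle-downBase m j j r-inside)
... | no  j≢k  = []≡multiplicity-pair q (downBase j r) (downBase k r)
                   (j≢k ∘ downBase-injectiveˡ j k) (shareTriangle-downBase m j k r-inside)

sharingBases-inside : ∀ m j k {r} → InTri m r → All (InTri (suc m)) (sharingBases j k r)
sharingBases-inside m j k r-inside with j ≟ˢ k
... | yes _ = downBase-inside m j r-inside ∷ []
... | no  _ = downBase-inside m j r-inside ∷ downBase-inside m k r-inside ∷ []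

-- The sides of a downward triangle are inner; only the one parallel to side₃ needs the bound on r.
∑-otherSharingBase : ∀ m j {r} → InTri m r →
  ∑ (λ k → count (offSide (suc m) k) (otherSharingBase j k r)) sides ≡ 2
∑-otherSharingBase m side₁ r-inside rewrite <⇒≡ᵇ-false (s≤s r-inside) = refl
∑-otherSharingBase m side₂ r-inside rewrite <⇒≡ᵇ-false (s≤s r-inside) = refl
∑-otherSharingBase m side₃ r-inside = refl

degree-downBase : ∀ m j {r} → InTri m r →
  count (shareTriangle (suc (suc m)) (edge j (downBase j r))) (innerEdges (suc (suc m)))
    ≡ 2 + innerCount (suc m) (downBase j r)
degree-downBase m j {r} r-inside = begin
  count S (innerEdges (suc (suc m)))
    ≡⟨ ∑-innerEdges (suc m) (λ f → [ S f ]) ⟩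
  ∑ (λ q → ∑ (λ k → [ off k q ] * [ S (edge k q) ]) sides) (pts (suc m))
    ≡⟨ ∑-cong (pts (suc m)) (λ q → ∑-cong sides (λ k →
         cong ([ off k q ] *_) (shareTriangle-multiplicity m j k {r} {q} r-inside))) ⟩
  ∑ (λ q → ∑ (λ k → [ off k q ] * multiplicity q (sharingBases j k r)) sides) (pts (suc m))
    ≡⟨ ∑-comm (λ q k → [ off k q ] * multiplicity q (sharingBases j k r)) (pts (suc m)) sides ⟩
  ∑ (λ k → ∑ (λ q → [ off k q ] * multiplicity q (sharingBases j k r)) (pts (suc m))) sides
    ≡⟨ ∑-cong sides (λ k → ∑-pts-multiplicity (suc m) (λ q → [ off k q ]) (sharingBases-inside m j k {r} r-inside)) ⟩
  ∑ (λ k → [ off k (downBase j r) ] + count (off k) (otherSharingBase j k r)) sides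
    ≡⟨ ∑-+ (λ k → [ off k (downBase j r) ]) (λ k → count (off k) (otherSharingBase j k r)) sides ⟩
  innerCount (suc m) (downBase j r) + ∑ (λ k → count (off k) (otherSharingBase j k r)) sides
    ≡⟨ cong (innerCount (suc m) (downBase j r) +_) (∑-otherSharingBase m j {r} r-inside) ⟩
  innerCount (suc m) (downBase j r) + 2
    ≡⟨ +-comm _ 2 ⟩
  2 + innerCount (suc m) (downBase j r) ∎
  where
  open ≡-Reasoning
  off : Side → Point → Bool
  off = offSide (suc m)
  S : Edge → Bool
  S = shareTriangle (suc (suc m)) (edge j (downBase j r))

∑-degrees : ∀ m →
  ∑ (λ e → count (shareTriangle (suc (suc m)) e) (innerEdges (suc (suc m)))) (innerEdges (suc (suc m)))
    ≡ ∑ (λ p → innerCount (suc m) p * (2 + innerCount (suc m) p)) (pts (suc m))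
∑-degrees m = begin
  ∑ deg (innerEdges (suc (suc m)))
    ≡⟨ ∑-innerEdges (suc m) deg ⟩
  ∑ (λ p → ∑ (λ j → [ offSide (suc m) j p ] * deg (edge j p)) sides) (pts (suc m))
    ≡⟨ ∑-congᴬ (pts-inside (suc m)) (λ {p} p-inside → ∑-cong sides (weighted p p-inside)) ⟩
  ∑ (λ p → ∑ (λ j → [ offSide (suc m) j p ] * (2 + innerCount (suc m) p)) sides) (pts (suc m))
    ≡⟨ ∑-cong (pts (suc m)) (λ p → ∑-*ʳ (λ j → [ offSide (suc m) j p ]) (2 + innerCount (suc m) p) sides) ⟩
  ∑ (λ p → innerCount (suc m) p * (2 + innerCount (suc m) p)) (pts (suc m)) ∎
  where
  open ≡-Reasoning
  deg : Edge → ℕ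
  deg e = count (shareTriangle (suc (suc m)) e) (innerEdges (suc (suc m)))
  weighted : ∀ p → InTri (suc m) p → ∀ j →
    [ offSide (suc m) j p ] * deg (edge j p) ≡ [ offSide (suc m) j p ] * (2 + innerCount (suc m) p)
  weighted p p-inside j with offSide (suc m) j p in off
  ... | false = refl
  ... | true with offSide-inside⇒downBase m j p-inside off
  ...   | r , r-inside , refl = cong (1 *_) (degree-downBase m j r-inside)

triangular : ℕ → ℕ
triangular zero    = 0
triangular (suc k) = k + triangular k

triangular-double : ∀ k → 2 * triangular k + k ≡ k * k
triangular-double zero    = refl
triangular-double (suc k) = begin
  2 * (k + triangular k) + suc k       ≡⟨ solve 2 (λ k t → con 2 :* (k :+ t) :+ (con 1 :+ k) := (con 2 :* t :+ k) :+ (con 2 :* k :+ con 1)) refl k (triangular k) ⟩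
  (2 * triangular k + k) + (2 * k + 1) ≡⟨ cong (_+ (2 * k + 1)) (triangular-double k) ⟩
  k * k + (2 * k + 1)                  ≡⟨ solve 1 (λ k → k :* k :+ (con 2 :* k :+ con 1) := (con 1 :+ k) :* (con 1 :+ k)) refl k ⟩
  suc k * suc k                        ∎
  where open ≡-Reasoning

sumTo-affine : ∀ k x y z → sumTo k (λ i → x + i * y + z) ≡ k * (x + z) + triangular k * y
sumTo-affine zero    x y z = refl
sumTo-affine (suc k) x y z = begin
  sumTo (suc k) (λ i → x + i * y + z)                       ≡⟨ sumTo-snoc k (λ i → x + i * y + z) ⟩
  sumTo k (λ i → x + i * y + z) + (x + k * y + z)           ≡⟨ cong (_+ (x + k * y + z)) (sumTo-affine k x y z) ⟩
  k * (x + z) + triangular k * y + (x + k * y + z)          ≡⟨ solve 5 (λ k t x y z → k :* (x :+ z) :+ t :* y :+ (x :+ k :* y :+ z)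
                                                                       := (con 1 :+ k) :* (x :+ z) :+ (k :+ t) :* y) refl k (triangular k) x y z ⟩
  suc k * (x + z) + triangular (suc k) * y                  ∎
  where open ≡-Reasoning

rowSum : (Bool → Bool → ℕ) → ℕ → ℕ
rowSum F zero    = F false false
rowSum F (suc l) = F false true + l * F true true + F true false

sumTo-row : ∀ (F : Bool → Bool → ℕ) l → sumTo (suc l) (λ b → F (not (b ≡ᵇ 0)) (not (b ≡ᵇ l))) ≡ rowSum F l
sumTo-row F zero    = +-identityʳ (F false false)
sumTo-row F (suc l) =
  trans (cong (F false true +_) interior-and-end) (sym (+-assoc (F false true) _ _))
  where
  open ≡-Reasoning
  interior-and-end : sumTo (suc l) (λ i → F true (not (i ≡ᵇ l))) ≡ l * F true true + F true false
  interior-and-end = begin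
    sumTo (suc l) (λ i → F true (not (i ≡ᵇ l)))                     ≡⟨ sumTo-snoc l (λ i → F true (not (i ≡ᵇ l))) ⟩
    sumTo l (λ i → F true (not (i ≡ᵇ l))) + F true (not (l ≡ᵇ l))
      ≡⟨ cong₂ _+_ (sumTo-cong l (λ i<l → cong (F true ∘ not) (<⇒≡ᵇ-false i<l)))
                   (cong (F true ∘ not) (Equivalence.to T-≡ (≡⇒≡ᵇ l l refl))) ⟩
    sumTo l (λ _ → F true true) + F true false                       ≡⟨ cong (_+ F true false) (sumTo-const l (F true true)) ⟩
    l * F true true + F true false                                   ∎

∑-pts-innerCount : ∀ k (g : ℕ → ℕ) →
  ∑ (g ∘ innerCount (suc k)) (pts (suc k)) ≡ 3 * g 1 + k * (3 * g 2) + triangular k * g 3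
∑-pts-innerCount k g = begin
  ∑ (g ∘ innerCount m) (pts m)
    ≡⟨ ∑-pts (g ∘ innerCount m) m ⟩
  sumTo (suc m) (λ a → sumTo (suc (m ∸ a)) (λ b → g (innerCount m (a , b))))
    ≡⟨ sumTo-cong (suc m) (λ {a} a<1+m → row a (≤-pred a<1+m)) ⟩
  sumTo (suc m) (λ a → rowSum (F (not (a ≡ᵇ 0))) (m ∸ a))
    ≡⟨ cong (rowSum (F false) m +_) (sumTo-reverse m (rowSum (F true))) ⟩
  rowSum (F false) m + (g 1 + sumTo k (λ i → g 2 + i * g 3 + g 2))
    ≡⟨ cong (λ s → rowSum (F false) m + (g 1 + s)) (sumTo-affine k (g 2) (g 3) (g 2)) ⟩
  (g 1 + k * g 2 + g 1) + (g 1 + (k * (g 2 + g 2) + triangular k * g 3))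
    ≡⟨ solve 5 (λ k t x y z → (x :+ k :* y :+ x) :+ (x :+ (k :* (y :+ y) :+ t :* z))
                              := con 3 :* x :+ k :* (con 3 :* y) :+ t :* z) refl k (triangular k) (g 1) (g 2) (g 3) ⟩
  3 * g 1 + k * (3 * g 2) + triangular k * g 3 ∎
  where
  open ≡-Reasoning
  m : ℕ
  m = suc k
  F : Bool → Bool → Bool → ℕ
  F α β γ = g ([ β ] + ([ α ] + ([ γ ] + 0)))
  row : ∀ a → a ≤ m → sumTo (suc (m ∸ a)) (λ b → g (innerCount m (a , b))) ≡ rowSum (F (not (a ≡ᵇ 0))) (m ∸ a)
  row a a≤m = trans (sumTo-cong (suc (m ∸ a)) (λ {b} _ → cong (F (not (a ≡ᵇ 0)) (not (b ≡ᵇ 0)) ∘ not) (+-≡ᵇ-shift a b a≤m)))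
                    (sumTo-row (F (not (a ≡ᵇ 0))) (m ∸ a))

length-innerEdges-closed : ∀ k → length (innerEdges (suc (suc k))) ≡ 3 + k * 6 + triangular k * 3
length-innerEdges-closed k = trans (length-innerEdges (suc k)) (∑-pts-innerCount k (λ c → c))

∑-degrees-closed : ∀ k →
  ∑ (λ e → count (shareTriangle (suc (suc k)) e) (innerEdges (suc (suc k)))) (innerEdges (suc (suc k)))
    ≡ 9 + k * 24 + triangular k * 15
∑-degrees-closed k = trans (∑-degrees k) (∑-pts-innerCount k (λ c → c * (2 + c)))

twice-length-innerEdges : ∀ k → 2 * length (innerEdges (suc (suc k))) ≡ 3 * suc (suc k) * suc k
twice-length-innerEdges k = begin
  2 * length (innerEdges (suc (suc k)))  ≡⟨ cong (2 *_) (length-innerEdges-closed k) ⟩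
  2 * (3 + k * 6 + t * 3)                ≡⟨ solve 2 (λ k t → con 2 :* (con 3 :+ k :* con 6 :+ t :* con 3)
                                                        := con 6 :+ con 9 :* k :+ con 3 :* (con 2 :* t :+ k)) refl k t ⟩
  6 + 9 * k + 3 * (2 * t + k)            ≡⟨ cong (λ x → 6 + 9 * k + 3 * x) (triangular-double k) ⟩
  6 + 9 * k + 3 * (k * k)                ≡⟨ solve 1 (λ k → con 6 :+ con 9 :* k :+ con 3 :* (k :* k)
                                                        := con 3 :* (con 2 :+ k) :* (con 1 :+ k)) refl k ⟩
  3 * suc (suc k) * suc k                ∎
  where
  open ≡-Reasoning
  t : ℕ
  t = triangular k

countPairs-shareTriangle : ∀ k → countPairs (shareTriangle (suc (suc k))) (innerEdges (suc (suc k))) ≡ 3 * suc k ^ 2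
countPairs-shareTriangle k = *-cancelˡ-≡ P (3 * suc k ^ 2) 2 (+-cancelʳ-≡ M (2 * P) (2 * (3 * suc k ^ 2)) (begin
  2 * P + M                                ≡⟨ cong (2 * P +_) (count-shareTriangle-refl (suc k)) ⟨
  2 * P + count (λ e → R e e) es           ≡⟨ countPairs-handshake R (shareTriangle-sym (suc (suc k))) es ⟩
  ∑ (λ e → count (R e) es) es              ≡⟨ ∑-degrees-closed k ⟩
  9 + k * 24 + t * 15                      ≡⟨ solve 2 (λ k t → con 9 :+ k :* con 24 :+ t :* con 15
                                                 := con 6 :* (con 1 :+ con 2 :* k :+ (con 2 :* t :+ k)) :+ (con 3 :+ k :* con 6 :+ t :* con 3)) refl k t ⟩
  6 * (1 + 2 * k + (2 * t + k)) + (3 + k * 6 + t * 3)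
    ≡⟨ cong₂ (λ x y → 6 * (1 + 2 * k + x) + y) (triangular-double k) (sym (length-innerEdges-closed k)) ⟩
  6 * (1 + 2 * k + k * k) + M              ≡⟨ cong (_+ M) (solve 1 (λ k → con 6 :* (con 1 :+ con 2 :* k :+ k :* k)
                                                 := con 2 :* (con 3 :* ((con 1 :+ k) :^ 2))) refl k) ⟩
  2 * (3 * suc k ^ 2) + M                  ∎))
  where
  open ≡-Reasoning
  es : List Edge
  es = innerEdges (suc (suc k))
  R : Edge → Edge → Bool
  R = shareTriangle (suc (suc k))
  P M t : ℕ
  P = countPairs R es
  M = length es
  t = triangular k

-- Adding Z = 24(k + 1)² + 4M to either side gives (2M)².
eightfold-closedForm : ∀ k {M N} → 2 * M ≡ 3 * suc (suc k) * suc k → N + 3 * suc k ^ 2 ≡ M C 2 →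
  8 * N ≡ 3 * suc k * k * (3 * suc (suc k) ^ 2 + 3 * suc (suc k) ∸ 4)
eightfold-closedForm k {M} {N} 2M≡X N+P≡C = +-cancelʳ-≡ Z (8 * N) _ (begin
  8 * N + Z                                     ≡⟨ solve 3 (λ k m n → con 8 :* n :+ (con 24 :* ((con 1 :+ k) :^ 2) :+ con 2 :* (con 2 :* m))
                                                     := con 4 :* (con 2 :* (n :+ con 3 :* ((con 1 :+ k) :^ 2)) :+ m)) refl k M N ⟩
  4 * (2 * (N + 3 * suc k ^ 2) + M)             ≡⟨ cong (λ c → 4 * (2 * c + M)) N+P≡C ⟩
  4 * (2 * (M C 2) + M)                         ≡⟨ cong (4 *_) (twice-C₂ M) ⟩
  4 * (M * M)                                   ≡⟨ solve 1 (λ m → con 4 :* (m :* m) := (con 2 :* m) :* (con 2 :* m)) refl M ⟩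
  (2 * M) * (2 * M)                             ≡⟨ cong₂ _*_ 2M≡X 2M≡X ⟩
  X * X                                         ≡⟨ solve 1 (λ k → (con 3 :* (con 2 :+ k) :* (con 1 :+ k)) :* (con 3 :* (con 2 :+ k) :* (con 1 :+ k))
                                                     := con 3 :* (con 1 :+ k) :* k :* (con 3 :* k :* k :+ con 15 :* k :+ con 14)
                                                        :+ (con 24 :* ((con 1 :+ k) :^ 2) :+ con 2 :* (con 3 :* (con 2 :+ k) :* (con 1 :+ k)))) refl k ⟩
  3 * suc k * k * q + (24 * suc k ^ 2 + 2 * X)  ≡⟨ cong₂ (λ x y → 3 * suc k * k * x + (24 * suc k ^ 2 + 2 * y)) ∸4 (sym 2M≡X) ⟩
  3 * suc k * k * (3 * suc (suc k) ^ 2 + 3 * suc (suc k) ∸ 4) + Z ∎)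
  where
  open ≡-Reasoning
  X Z q : ℕ
  X = 3 * suc (suc k) * suc k
  Z = 24 * suc k ^ 2 + 2 * (2 * M)
  q = 3 * k * k + 15 * k + 14
  ∸4 : q ≡ 3 * suc (suc k) ^ 2 + 3 * suc (suc k) ∸ 4
  ∸4 = sym (trans (cong (_∸ 4) (solve 1 (λ k → con 3 :* ((con 2 :+ k) :^ 2) :+ con 3 :* (con 2 :+ k) := con 4 :+ (con 3 :* k :* k :+ con 15 :* k :+ con 14)) refl k))
                  (m+n∸m≡n 4 q))

Mpred≡length-innerEdges : ∀ k → Mpred (suc (suc k)) ≡ length (innerEdges (suc (suc k)))
Mpred≡length-innerEdges k = trans (cong (_/ 2) (trans (sym (twice-length-innerEdges k)) (*-comm 2 M))) (m*n/n≡m M 2)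
  where
  M : ℕ
  M = length (innerEdges (suc (suc k)))

mainTheorem2 : (n : ℕ) → 1 ≤ n →
    (L n 2 ≡ Mpred n C 2 ∸ 3 * (n ∸ 1) ^ 2)
    × (8 * L n 2 ≡ 3 * (n ∸ 1) * (n ∸ 2) * (3 * n ^ 2 + 3 * n ∸ 4))
mainTheorem2 (suc zero) _ = refl , refl
mainTheorem2 n@(suc (suc k)) _ = L≡C∸P , 8L≡closedForm
  where
  open ≡-Reasoning
  es : List Edge
  es = innerEdges n
  N P : ℕ
  N = countPairs (λ e f → not (shareTriangle n e f)) es
  P = 3 * suc k ^ 2
  L≡N : L n 2 ≡ N
  L≡N = L-2≡countPairs n
  N+P≡C : N + P ≡ length es C 2
  N+P≡C = trans (cong (N +_) (sym (countPairs-shareTriangle k))) (countPairs-complement (shareTriangle n) es)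
  L≡C∸P : L n 2 ≡ Mpred n C 2 ∸ P
  L≡C∸P = begin
    L n 2               ≡⟨ L≡N ⟩
    N                   ≡⟨ m+n∸n≡m N P ⟨
    N + P ∸ P           ≡⟨ cong (_∸ P) N+P≡C ⟩
    length es C 2 ∸ P   ≡⟨ cong (λ x → x C 2 ∸ P) (Mpred≡length-innerEdges k) ⟨
    Mpred n C 2 ∸ P     ∎
  8L≡closedForm : 8 * L n 2 ≡ 3 * suc k * k * (3 * n ^ 2 + 3 * n ∸ 4)
  8L≡closedForm = trans (cong (8 *_) L≡N) (eightfold-closedForm k {length es} (twice-length-innerEdges k) N+P≡C)
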